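{- Let $\mathcal{X}$ be a finite set with $n$ elements and $\mathcal{C}^0$ a simplicial complex on $\mathcal{X}$. Consider the simplicial complex Markov chain started at $X_0=\mathcal{C}^0$. Let $G^0$ be the graph of the $1$-skeleton of $\mathcal{C}^0$ and $p_0(x)$ its chromatic polynomial. Then for every $k\ge0$, the probability that the chain is absorbed after $k$ steps (i.e. $X_k$ is the complex consisting only of the $n$ isolated vertices) equals $p_0(2^k)/2^{nk}$.
   Context: A simplicial complex $\mathcal{C}$ on $\mathcal{X}$ is a collection of nonempty subsets of $\mathcal{X}$, containing every singleton $\{x\}$, $x\in\mathcal{X}$, and closed under taking nonempty subsets. For $S\subseteq\mathcal{X}$, $\mathcal{C}_S=\{A\in\mathcal{C}:A\subseteq S\}$. The simplicial complex Markov chain: from a complex $\mathcal{C}$ on $\mathcal{X}$, color each vertex red or blue independently with probability $1/2$; if $R$ is the set of red vertices, move to $\mathcal{C}_R\cup\mathcal{C}_{\mathcal{X}\setminus R}$. The absorbing state is the complex of isolated vertices $\{\{x\}:x\in\mathcal{X}\}$. The $1$-skeleton graph $G^0$ has vertex set $\mathcal{X}$ and an edge $\{x,y\}$ whenever $\{x,y\}\in\mathcal{C}^0$; its chromatic polynomial $p_0(q)$ counts proper colorings of $G^0$ with $q$ colors. -}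

module Defs where

open import Data.Bool using (Bool; true; false; T; _∧_; _∨_; not; if_then_else_)
open import Data.Nat using (ℕ; zero; suc; _*_; _^_; _≡ᵇ_)
open import Data.Nat.Properties using (m^n≢0)
open import Data.Fin using (Fin)
open import Data.Fin.Properties using (_≟_)
open import Data.Fin.Subset using (Subset; ⁅_⁆; _∪_; _⊆_; ∁; ∣_∣; Nonempty)
open import Data.Vec using (Vec; []; _∷_; lookup)
open import Data.List using (List; []; _∷_; [_]; concatMap; map; filterᵇ; length; allFin; foldr)
open import Data.Integer using (+_)
open import Data.Rational.Unnormalised using (ℚᵘ; _/_)
open import Relation.Nullary.Decidable using (⌊_⌋)

record SimplicialComplex (n : ℕ) : Set where
  field
    mem        : Subset n → Bool
    nonempty   : ∀ A → T (mem A) → Nonempty A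
    singletons : ∀ x → T (mem ⁅ x ⁆)
    downClosed : ∀ A B → Nonempty B → B ⊆ A → T (mem A) → T (mem B)
open SimplicialComplex public

subᵇ : ∀ {n} → Subset n → Subset n → Bool
subᵇ []       []       = true
subᵇ (a ∷ A) (b ∷ B) = (not a ∨ b) ∧ subᵇ A B

-- One step of the chain, given the set R of red vertices:
-- C ↦ C_R ∪ C_{𝒳 ∖ R}  (acting on membership predicates)
step : ∀ {n} → Subset n → (Subset n → Bool) → (Subset n → Bool)
step R C A = C A ∧ (subᵇ A R ∨ subᵇ A (∁ R))

run : ∀ {n k} → Vec (Subset n) k → (Subset n → Bool) → (Subset n → Bool)
run []       C = C
run (R ∷ Rs) C = run Rs (step R C)

allVecs : ∀ {a} {A : Set a} → List A → (n : ℕ) → List (Vec A n)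
allVecs xs zero    = [ [] ]
allVecs xs (suc n) = concatMap (λ x → map (x ∷_) (allVecs xs n)) xs

allSubsets : (n : ℕ) → List (Subset n)
allSubsets n = allVecs (true ∷ false ∷ []) n

allᵇ : ∀ {a} {A : Set a} → (A → Bool) → List A → Bool
allᵇ p = foldr (λ x b → p x ∧ b) true

_==_ : Bool → Bool → Bool
true  == b = b
false == b = not b

absorbedᵇ : ∀ {n} → (Subset n → Bool) → Bool
absorbedᵇ {n} C = allᵇ (λ A → C A == (∣ A ∣ ≡ᵇ 1)) (allSubsets n)

absorbedCount : ∀ {n} → SimplicialComplex n → ℕ → ℕ
absorbedCount {n} C k = length (filterᵇ (λ Rs → absorbedᵇ (run Rs (mem C))) (allVecs (allSubsets n) k))

-- P(X_k is absorbing | X_0 = C): each of the 2^(nk) coloring sequences is equally likely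
absorptionProbability : ∀ {n} → SimplicialComplex n → ℕ → ℚᵘ
absorptionProbability {n} C k =
  _/_ (+ absorbedCount C k) (2 ^ (n * k)) {{m^n≢0 2 (n * k)}}

-- 1-skeleton graph G⁰: edge {x,y} (x ≠ y) iff {x,y} ∈ C
edgeᵇ : ∀ {n} → SimplicialComplex n → Fin n → Fin n → Bool
edgeᵇ C i j = mem C (⁅ i ⁆ ∪ ⁅ j ⁆) ∧ not ⌊ i ≟ j ⌋

properᵇ : ∀ {n q} → SimplicialComplex n → Vec (Fin q) n → Bool
properᵇ {n} C c =
  allᵇ (λ i → allᵇ (λ j → not (edgeᵇ C i j) ∨ not ⌊ lookup c i ≟ lookup c j ⌋) (allFin n)) (allFin n)

chromaticPolynomial : ∀ {n} → SimplicialComplex n → ℕ → ℕ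
chromaticPolynomial {n} C q = length (filterᵇ (properᵇ C) (allVecs (allFin q) n))

-- Write the k colourings R₁, …, R_k of a run as one colouring of the vertices by bit strings of length k
-- (the transpose of the sequence of rows). Each step keeps exactly the faces on which its colouring is
-- constant, so X_k consists of the faces of C⁰ that are monochromatic for the bit-string colouring. Since
-- every singleton is a face and faces are closed under subsets, X_k is the complex of isolated vertices
-- iff no edge of G⁰ is monochromatic, i.e. iff the colouring is a proper colouring of G⁰ with 2^k colours.
-- Transposition and the binary encoding of bit strings as Fin (2^k) are bijections, so exactly p₀(2^k)
-- of the 2^(nk) equally likely runs are absorbed after k steps.
module Submission where

open import Defs
open import Data.Bool using (Bool; true; false; T; _∧_; _∨_; not; if_then_else_)
open import Data.Bool.Properties using (∧-identityʳ; ∧-assoc; ¬-not; T-∧; T-∨; T-≡; ⇔→≡)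
open import Data.Unit using (tt)
open import Data.Nat using (ℕ; zero; suc; _+_; _*_; _^_; _≤_; s≤s; _≡ᵇ_)
open import Data.Nat.Properties using (m^n≢0; +-assoc; ≤-trans; +-commutativeSemigroup)
open import Algebra.Properties.CommutativeSemigroup +-commutativeSemigroup using (interchange)
open import Data.Fin using (Fin; zero; suc; _↑ˡ_; _↑ʳ_; combine)
open import Data.Fin.Properties using (combine-injective; _≟_; any?)
open import Data.Fin.Subset using (Subset; _∈_; _⊆_; ∁; ⁅_⁆; _∪_; ∣_∣; ⊥)
open import Data.Fin.Subset.Properties
  using ( in⊆in-⇔; out⊆-⇔; _⊆?_; _∈?_; x∈∁p⇒x∉p; x∉p⇒x∈∁p; x∈⁅x⁆; x∈⁅y⁆⇒x≡y; ∣⁅x⁆∣≡1; p⊆q⇒∣p∣≤∣q∣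
        ; x∈p∪q⁺; x∈p∪q⁻; x∈p∧x≢y⇒x∈p-y; x∈p⇒∣p-x∣<∣p∣; nonempty?; Empty-unique; ∣⊥∣≡0; ⊆-antisym)
open import Data.List
  using (List; []; _∷_; [_]; _++_; map; concatMap; filterᵇ; length; tabulate; allFin; cartesianProduct)
open import Data.Vec using (Vec; []; _∷_; here; lookup; zipWith; replicate; transpose) renaming (map to vmap)
open import Data.Vec.Properties
  using (lookup-map; zipWith-is-⊛; []=⇒lookup; lookup⇒[]=; lookup-zipWith; tabulate∘lookup; tabulate-cong)
import Data.Vec as Vec
open import Data.Product using (_×_; _,_; proj₁; proj₂; uncurry; ∃₂) renaming (map to ×-map)
open import Data.Product.Function.NonDependent.Propositional using (_×-cong_)
open import Data.Sum using (_⊎_; inj₁; inj₂)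
import Data.Sum as Sum
open import Data.Empty using (⊥-elim)
import Data.List.Membership.Propositional as List
open import Data.List.Membership.Propositional.Properties using (∈-allFin; ∈-map⁺; ∈-concatMap⁺)
import Data.List.Relation.Unary.Any as Any
open import Data.List.Relation.Unary.All using (All; []; _∷_)
import Data.List.Relation.Unary.All as All
open import Relation.Nullary using (yes; no; ¬?; _×-dec_)
open import Relation.Nullary.Decidable using (⌊_⌋; decidable-stable)
open import Function using (_∘_; id; _⇔_; mk⇔; Equivalence; case_of_)
open import Function.Properties.Equivalence using (⇔-setoid) renaming (refl to ⇔-refl; trans to ⇔-trans; sym to ⇔-sym)
open import Relation.Binary.PropositionalEquality hiding ([_])
open import Level using (Level; 0ℓ)
import Relation.Binary.Reasoning.Setoid as SetoidReasoning
module ⇔-Reasoning = SetoidReasoning (⇔-setoid 0ℓ)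

private
  variable
    a a′ b b′ c : Level
    A : Set a
    A′ : Set a′
    B : Set b
    B′ : Set b′
    Z : Set c

-- Sums over lists and their reindexing

∑ : List A → (A → ℕ) → ℕ
∑ []       f = 0
∑ (x ∷ xs) f = f x + ∑ xs f

syntax ∑ xs (λ x → e) = ∑[ x ∈ xs ] e

∑-cong : ∀ (xs : List A) {f g : A → ℕ} → (∀ x → f x ≡ g x) → ∑ xs f ≡ ∑ xs g
∑-cong []       f≗g = refl
∑-cong (x ∷ xs) f≗g = cong₂ _+_ (f≗g x) (∑-cong xs f≗g)

∑-++ : ∀ (xs ys : List A) f → ∑ (xs ++ ys) f ≡ ∑ xs f + ∑ ys f
∑-++ []       ys f = refl
∑-++ (x ∷ xs) ys f = trans (cong (f x +_) (∑-++ xs ys f)) (sym (+-assoc (f x) _ _))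

∑-zero : ∀ (xs : List A) → ∑[ x ∈ xs ] 0 ≡ 0
∑-zero []       = refl
∑-zero (x ∷ xs) = ∑-zero xs

∑-distrib-+ : ∀ (xs : List A) f g → ∑[ x ∈ xs ] (f x + g x) ≡ ∑ xs f + ∑ xs g
∑-distrib-+ []       f g = refl
∑-distrib-+ (x ∷ xs) f g =
  trans (cong (f x + g x +_) (∑-distrib-+ xs f g)) (interchange (f x) (g x) (∑ xs f) (∑ xs g))

length-filterᵇ : ∀ (p : A → Bool) xs → length (filterᵇ p xs) ≡ ∑[ x ∈ xs ] (if p x then 1 else 0)
length-filterᵇ p []       = refl
length-filterᵇ p (x ∷ xs) with p x
... | true  = cong suc (length-filterᵇ p xs)
... | false = length-filterᵇ p xs

∑-map : ∀ (g : A → B) xs f → ∑ (map g xs) f ≡ ∑ xs (f ∘ g)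
∑-map g []       f = refl
∑-map g (x ∷ xs) f = cong (f (g x) +_) (∑-map g xs f)

∑-concatMap : ∀ (g : A → List B) xs f → ∑ (concatMap g xs) f ≡ ∑[ x ∈ xs ] ∑ (g x) f
∑-concatMap g []       f = refl
∑-concatMap g (x ∷ xs) f = trans (∑-++ (g x) _ f) (cong (∑ (g x) f +_) (∑-concatMap g xs f))

∑-cartesianProduct : ∀ (xs : List A) (ys : List B) f →
                     ∑ (cartesianProduct xs ys) f ≡ ∑[ x ∈ xs ] ∑[ y ∈ ys ] f (x , y)
∑-cartesianProduct []       ys f = refl
∑-cartesianProduct (x ∷ xs) ys f = begin
  ∑ (map (x ,_) ys ++ cartesianProduct xs ys) f
    ≡⟨ ∑-++ (map (x ,_) ys) _ f ⟩
  ∑ (map (x ,_) ys) f + ∑ (cartesianProduct xs ys) f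
    ≡⟨ cong₂ _+_ (∑-map (x ,_) ys f) (∑-cartesianProduct xs ys f) ⟩
  ∑[ y ∈ ys ] f (x , y) + ∑[ x′ ∈ xs ] ∑[ y ∈ ys ] f (x′ , y)
    ∎
  where open ≡-Reasoning

∑-allVecs-suc : ∀ (xs : List A) n (f : Vec A (suc n) → ℕ) →
                ∑ (allVecs xs (suc n)) f ≡ ∑[ x ∈ xs ] ∑[ v ∈ allVecs xs n ] f (x ∷ v)
∑-allVecs-suc xs n f = trans (∑-concatMap _ xs f) (∑-cong xs (λ x → ∑-map (x ∷_) (allVecs xs n) f))

∑-comm : ∀ (xs : List A) (ys : List B) (f : A → B → ℕ) →
         ∑[ x ∈ xs ] ∑[ y ∈ ys ] f x y ≡ ∑[ y ∈ ys ] ∑[ x ∈ xs ] f x y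
∑-comm []       ys f = sym (∑-zero ys)
∑-comm (x ∷ xs) ys f = trans (cong (∑ ys (f x) +_) (∑-comm xs ys f))
                             (sym (∑-distrib-+ ys (f x) _))

record Enumerates {A : Set a} (e : B → A) (ys : List B) (xs : List A) : Set a where
  field
    reindex : ∀ f → ∑ xs f ≡ ∑ ys (f ∘ e)
open Enumerates

Enumerates-id : ∀ {xs : List A} → Enumerates id xs xs
Enumerates-id .reindex f = refl

Enumerates-∘ : ∀ {e : B → A} {e′ : Z → B} {xs ys zs} →
               Enumerates e ys xs → Enumerates e′ zs ys → Enumerates (e ∘ e′) zs xs
Enumerates-∘ {e = e} e-enum e′-enum .reindex f = trans (reindex e-enum f) (reindex e′-enum (f ∘ e))

count-Enumerates : ∀ {e : B → A} {xs ys} → Enumerates e ys xs →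
                   ∀ {p q} → (∀ y → p (e y) ≡ q y) → length (filterᵇ p xs) ≡ length (filterᵇ q ys)
count-Enumerates {e = e} {xs} {ys} e-enum {p} {q} p∘e≗q = begin
  length (filterᵇ p xs)                   ≡⟨ length-filterᵇ p xs ⟩
  ∑[ x ∈ xs ] (if p x then 1 else 0)      ≡⟨ reindex e-enum _ ⟩
  ∑[ y ∈ ys ] (if p (e y) then 1 else 0)  ≡⟨ ∑-cong ys (λ y → cong (if_then 1 else 0) (p∘e≗q y)) ⟩
  ∑[ y ∈ ys ] (if q y then 1 else 0)      ≡⟨ sym (length-filterᵇ q ys) ⟩
  length (filterᵇ q ys)                   ∎
  where open ≡-Reasoning

Enumerates-cartesianProduct : ∀ {e : A′ → A} {e′ : B′ → B} {xs ys xs′ ys′} →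
  Enumerates e xs′ xs → Enumerates e′ ys′ ys →
  Enumerates (×-map e e′) (cartesianProduct xs′ ys′) (cartesianProduct xs ys)
Enumerates-cartesianProduct {e = e} {e′} {xs} {ys} {xs′} {ys′} e-enum e′-enum .reindex f = begin
  ∑ (cartesianProduct xs ys) f               ≡⟨ ∑-cartesianProduct xs ys f ⟩
  ∑[ x ∈ xs ] ∑[ y ∈ ys ] f (x , y)           ≡⟨ reindex e-enum _ ⟩
  ∑[ x ∈ xs′ ] ∑[ y ∈ ys ] f (e x , y)        ≡⟨ ∑-cong xs′ (λ x → reindex e′-enum _) ⟩
  ∑[ x ∈ xs′ ] ∑[ y ∈ ys′ ] f (e x , e′ y)    ≡⟨ sym (∑-cartesianProduct xs′ ys′ _) ⟩
  ∑ (cartesianProduct xs′ ys′) (f ∘ ×-map e e′) ∎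
  where open ≡-Reasoning

allVecs-suc-Enumerates : ∀ (xs : List A) n →
  Enumerates (uncurry _∷_) (cartesianProduct xs (allVecs xs n)) (allVecs xs (suc n))
allVecs-suc-Enumerates xs n .reindex f =
  trans (∑-allVecs-suc xs n f) (sym (∑-cartesianProduct xs (allVecs xs n) _))

allVecs-Enumerates : ∀ {e : B → A} {xs ys} n →
  Enumerates e ys xs → Enumerates (vmap e) (allVecs ys n) (allVecs xs n)
allVecs-Enumerates zero    e-enum .reindex f = refl
allVecs-Enumerates {e = e} {xs} {ys} (suc n) e-enum .reindex f = begin
  ∑ (allVecs xs (suc n)) f                             ≡⟨ ∑-allVecs-suc xs n f ⟩
  ∑[ x ∈ xs ] ∑[ v ∈ allVecs xs n ] f (x ∷ v)           ≡⟨ reindex e-enum _ ⟩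
  ∑[ y ∈ ys ] ∑[ v ∈ allVecs xs n ] f (e y ∷ v)         ≡⟨ ∑-cong ys (λ y → reindex (allVecs-Enumerates n e-enum) _) ⟩
  ∑[ y ∈ ys ] ∑[ w ∈ allVecs ys n ] f (e y ∷ vmap e w)  ≡⟨ sym (∑-allVecs-suc ys n _) ⟩
  ∑ (allVecs ys (suc n)) (f ∘ vmap e)                  ∎
  where open ≡-Reasoning

allVecs-zipWith-Enumerates : ∀ {c : A → B → Z} {xs ys zs} n →
  Enumerates (uncurry c) (cartesianProduct xs ys) zs →
  Enumerates (uncurry (zipWith c)) (cartesianProduct (allVecs xs n) (allVecs ys n)) (allVecs zs n)
allVecs-zipWith-Enumerates zero    c-enum .reindex f = refl
allVecs-zipWith-Enumerates {c = c} {xs} {ys} {zs} (suc n) c-enum .reindex f = begin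
  ∑ (allVecs zs (suc n)) f
    ≡⟨ ∑-allVecs-suc zs n f ⟩
  ∑[ z ∈ zs ] ∑[ v ∈ allVecs zs n ] f (z ∷ v)
    ≡⟨ ∑-cong zs (λ z → reindex (allVecs-zipWith-Enumerates n c-enum) _) ⟩
  ∑[ z ∈ zs ] ∑ (cartesianProduct xsⁿ ysⁿ) (λ uw → f (z ∷ uncurry (zipWith c) uw))
    ≡⟨ reindex c-enum _ ⟩
  ∑ (cartesianProduct xs ys)
    (λ xy → ∑ (cartesianProduct xsⁿ ysⁿ) (λ uw → f (uncurry c xy ∷ uncurry (zipWith c) uw)))
    ≡⟨ ∑-cartesianProduct xs ys _ ⟩
  ∑[ x ∈ xs ] ∑[ y ∈ ys ] ∑ (cartesianProduct xsⁿ ysⁿ) (λ uw → f (c x y ∷ uncurry (zipWith c) uw))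
    ≡⟨ ∑-cong xs (λ x → ∑-cong ys (λ y → ∑-cartesianProduct xsⁿ ysⁿ _)) ⟩
  ∑[ x ∈ xs ] ∑[ y ∈ ys ] ∑[ u ∈ xsⁿ ] ∑[ w ∈ ysⁿ ] f (c x y ∷ zipWith c u w)
    ≡⟨ ∑-cong xs (λ x → ∑-comm ys xsⁿ _) ⟩
  ∑[ x ∈ xs ] ∑[ u ∈ xsⁿ ] ∑[ y ∈ ys ] ∑[ w ∈ ysⁿ ] f (c x y ∷ zipWith c u w)
    ≡⟨ ∑-cong xs (λ x → ∑-cong xsⁿ (λ u → sym (∑-allVecs-suc ys n _))) ⟩
  ∑[ x ∈ xs ] ∑[ u ∈ xsⁿ ] ∑[ w ∈ allVecs ys (suc n) ] f (zipWith c (x ∷ u) w)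
    ≡⟨ sym (∑-allVecs-suc xs n _) ⟩
  ∑[ u ∈ allVecs xs (suc n) ] ∑[ w ∈ allVecs ys (suc n) ] f (zipWith c u w)
    ≡⟨ sym (∑-cartesianProduct (allVecs xs (suc n)) (allVecs ys (suc n)) _) ⟩
  ∑ (cartesianProduct (allVecs xs (suc n)) (allVecs ys (suc n))) (f ∘ uncurry (zipWith c))
    ∎
  where
  open ≡-Reasoning
  xsⁿ = allVecs xs n
  ysⁿ = allVecs ys n

allVecs-singleton : ∀ (x : A) n → allVecs [ x ] n ≡ [ replicate n x ]
allVecs-singleton x zero    = refl
allVecs-singleton x (suc n) = cong (λ vs → map (x ∷_) vs ++ []) (allVecs-singleton x n)

transpose-∷ : ∀ {k n} (u : Vec A k) (w : Vec (Vec A k) n) → transpose (u ∷ w) ≡ zipWith _∷_ u (transpose w)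
transpose-∷ u w = sym (zipWith-is-⊛ _∷_ u (transpose w))

allVecs-transpose-Enumerates : ∀ (xs : List A) k n →
  Enumerates transpose (allVecs (allVecs xs k) n) (allVecs (allVecs xs n) k)
allVecs-transpose-Enumerates xs k zero    .reindex f = cong (λ vs → ∑ vs f) (allVecs-singleton [] k)
allVecs-transpose-Enumerates xs k (suc n) .reindex f = begin
  ∑ (allVecs (allVecs xs (suc n)) k) f
    ≡⟨ reindex (allVecs-zipWith-Enumerates k (allVecs-suc-Enumerates xs n)) f ⟩
  ∑ (cartesianProduct rows (allVecs (allVecs xs n) k)) (f ∘ uncurry (zipWith _∷_))
    ≡⟨ reindex (Enumerates-cartesianProduct (Enumerates-id {xs = rows}) (allVecs-transpose-Enumerates xs k n))
               (f ∘ uncurry (zipWith _∷_)) ⟩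
  ∑ (cartesianProduct rows (allVecs rows n)) (λ (u , w) → f (zipWith _∷_ u (transpose w)))
    ≡⟨ ∑-cong (cartesianProduct rows (allVecs rows n)) (λ (u , w) → cong f (sym (transpose-∷ u w))) ⟩
  ∑ (cartesianProduct rows (allVecs rows n)) (f ∘ transpose ∘ uncurry _∷_)
    ≡⟨ sym (reindex (allVecs-suc-Enumerates rows n) (f ∘ transpose)) ⟩
  ∑ (allVecs rows (suc n)) (f ∘ transpose)
    ∎
  where
  open ≡-Reasoning
  rows = allVecs xs k

-- Bit strings of length k as elements of Fin (2 ^ k)

tabulate-Enumerates : ∀ {m} (g : Fin m → A) → Enumerates g (allFin m) (tabulate g)
tabulate-Enumerates {m = zero}  g .reindex f = refl
tabulate-Enumerates {m = suc m} g .reindex f = cong (f (g zero) +_)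
  (trans (reindex (tabulate-Enumerates (g ∘ suc)) f) (sym (reindex (tabulate-Enumerates suc) (f ∘ g))))

∑-allFin-+ : ∀ m {n} (f : Fin (m + n) → ℕ) →
             ∑ (allFin (m + n)) f ≡ ∑[ i ∈ allFin m ] f (i ↑ˡ n) + ∑[ j ∈ allFin n ] f (m ↑ʳ j)
∑-allFin-+ zero    f = refl
∑-allFin-+ (suc m) {n} f = begin
  f zero + ∑ (tabulate suc) f
    ≡⟨ cong (f zero +_) (trans (reindex (tabulate-Enumerates suc) f) (∑-allFin-+ m (f ∘ suc))) ⟩
  f zero + (∑[ i ∈ allFin m ] f (suc i ↑ˡ n) + ∑[ j ∈ allFin n ] f (suc m ↑ʳ j))
    ≡⟨ sym (+-assoc (f zero) _ _) ⟩
  f zero + ∑[ i ∈ allFin m ] f (suc i ↑ˡ n) + ∑[ j ∈ allFin n ] f (suc m ↑ʳ j)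
    ≡⟨ cong (λ s → f zero + s + ∑[ j ∈ allFin n ] f (suc m ↑ʳ j))
            (sym (reindex (tabulate-Enumerates suc) (f ∘ (_↑ˡ n)))) ⟩
  f zero + ∑ (tabulate suc) (f ∘ (_↑ˡ n)) + ∑[ j ∈ allFin n ] f (suc m ↑ʳ j)
    ∎
  where open ≡-Reasoning

allFin-combine-Enumerates : ∀ m n →
  Enumerates (uncurry combine) (cartesianProduct (allFin m) (allFin n)) (allFin (m * n))
allFin-combine-Enumerates zero    n .reindex f = refl
allFin-combine-Enumerates (suc m) n .reindex f = begin
  ∑ (allFin (n + m * n)) f
    ≡⟨ ∑-allFin-+ n {m * n} f ⟩
  row₀ + ∑[ l ∈ allFin (m * n) ] f (n ↑ʳ l)
    ≡⟨ cong (row₀ +_) (reindex (allFin-combine-Enumerates m n) (f ∘ (n ↑ʳ_))) ⟩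
  row₀ + ∑ (cartesianProduct (allFin m) (allFin n)) (λ (i , j) → f (combine (suc i) j))
    ≡⟨ cong (row₀ +_) (∑-cartesianProduct (allFin m) (allFin n) (λ (i , j) → f (combine (suc i) j))) ⟩
  row₀ + ∑[ i ∈ allFin m ] ∑[ j ∈ allFin n ] f (combine (suc i) j)
    ≡⟨ cong (row₀ +_) (sym (reindex (tabulate-Enumerates {m = m} suc) (λ i → ∑[ j ∈ allFin n ] f (combine i j)))) ⟩
  ∑[ i ∈ allFin (suc m) ] ∑[ j ∈ allFin n ] f (combine i j)
    ≡⟨ sym (∑-cartesianProduct (allFin (suc m)) (allFin n) (f ∘ uncurry combine)) ⟩
  ∑ (cartesianProduct (allFin (suc m)) (allFin n)) (f ∘ uncurry combine)
    ∎
  where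
  open ≡-Reasoning
  row₀ = ∑[ j ∈ allFin n ] f (j ↑ˡ m * n)

bit : Bool → Fin 2
bit true  = zero
bit false = suc zero

encode : ∀ {k} → Vec Bool k → Fin (2 ^ k)
encode []      = zero
encode (b ∷ v) = combine (bit b) (encode v)

bit-Enumerates : Enumerates bit (true ∷ false ∷ []) (allFin 2)
bit-Enumerates .reindex f = refl

bit-injective : ∀ {a b} → bit a ≡ bit b → a ≡ b
bit-injective {true}  {true}  _ = refl
bit-injective {false} {false} _ = refl

encode-injective : ∀ {k} {u v : Vec Bool k} → encode u ≡ encode v → u ≡ v
encode-injective {u = []}    {[]}    _  = refl
encode-injective {u = a ∷ u} {b ∷ v} eq with combine-injective (bit a) (encode u) (bit b) (encode v) eq
... | a≡b , u≡v = cong₂ _∷_ (bit-injective a≡b) (encode-injective u≡v)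

allFin-encode-Enumerates : ∀ k → Enumerates encode (allSubsets k) (allFin (2 ^ k))
allFin-encode-Enumerates zero    .reindex f = refl
allFin-encode-Enumerates (suc k) .reindex f = trans
  (reindex (Enumerates-∘ (allFin-combine-Enumerates 2 (2 ^ k))
                         (Enumerates-cartesianProduct bit-Enumerates (allFin-encode-Enumerates k))) f)
  (sym (reindex (allVecs-suc-Enumerates (true ∷ false ∷ []) k) (f ∘ encode)))

-- The faces that survive a run of the chain

monochromaticᵇ : ∀ {n} → Subset n → Subset n → Bool
monochromaticᵇ R A = subᵇ A R ∨ subᵇ A (∁ R)

survivesᵇ : ∀ {n k} → Vec (Subset n) k → Subset n → Bool
survivesᵇ []       A = true
survivesᵇ (R ∷ Rs) A = monochromaticᵇ R A ∧ survivesᵇ Rs A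

run-survivesᵇ : ∀ {n k} (Rs : Vec (Subset n) k) C A → run Rs C A ≡ C A ∧ survivesᵇ Rs A
run-survivesᵇ []       C A = sym (∧-identityʳ (C A))
run-survivesᵇ (R ∷ Rs) C A = trans (run-survivesᵇ Rs (step R C) A) (∧-assoc (C A) _ _)

Monochromatic : ∀ {n} → (Fin n → A) → Subset n → Set _
Monochromatic κ S = ∀ {i j} → i ∈ S → j ∈ S → κ i ≡ κ j

T-subᵇ : ∀ {n} (S R : Subset n) → T (subᵇ S R) ⇔ S ⊆ R
T-subᵇ []           []           = mk⇔ (λ _ {i} → λ ()) (λ _ → tt)
T-subᵇ (true  ∷ S) (true  ∷ R) = ⇔-trans (T-subᵇ S R) in⊆in-⇔
T-subᵇ (true  ∷ S) (false ∷ R) = mk⇔ (λ ()) (λ S⊆R → case S⊆R here of λ ())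
T-subᵇ (false ∷ S) (r     ∷ R) = ⇔-trans (T-subᵇ S R) out⊆-⇔

∈∁⇒lookup≡false : ∀ {n} {i : Fin n} (R : Subset n) → i ∈ ∁ R → lookup R i ≡ false
∈∁⇒lookup≡false {i = i} R i∈∁R = ¬-not (x∈∁p⇒x∉p i∈∁R ∘ lookup⇒[]= i R)

T-monochromaticᵇ : ∀ {n} (R S : Subset n) → T (monochromaticᵇ R S) ⇔ Monochromatic (lookup R) S
T-monochromaticᵇ R S = mk⇔ sound complete
  where
  open Equivalence
  sound : T (monochromaticᵇ R S) → Monochromatic (lookup R) S
  sound h i∈S j∈S with to T-∨ h
  ... | inj₁ S⊆R  = trans ([]=⇒lookup (S⊆R′ i∈S)) (sym ([]=⇒lookup (S⊆R′ j∈S)))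
    where S⊆R′ = to (T-subᵇ S R) S⊆R
  ... | inj₂ S⊆∁R = trans (∈∁⇒lookup≡false R (S⊆∁R′ i∈S)) (sym (∈∁⇒lookup≡false R (S⊆∁R′ j∈S)))
    where S⊆∁R′ = to (T-subᵇ S (∁ R)) S⊆∁R
  complete : Monochromatic (lookup R) S → T (monochromaticᵇ R S)
  complete mono with S ⊆? R
  ... | yes S⊆R = from T-∨ (inj₁ (from (T-subᵇ S R) S⊆R))
  ... | no  S⊈R = from T-∨ (inj₂ (from (T-subᵇ S (∁ R)) S⊆∁R))
    where
    S⊆∁R : S ⊆ ∁ R
    S⊆∁R {i} i∈S = x∉p⇒x∈∁p λ i∈R →
      S⊈R λ {j} j∈S → lookup⇒[]= j R (trans (mono j∈S i∈S) ([]=⇒lookup i∈R))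

T-survivesᵇ : ∀ {n k} (Rs : Vec (Subset n) k) S →
              T (survivesᵇ Rs S) ⇔ (∀ r → Monochromatic (lookup (lookup Rs r)) S)
T-survivesᵇ []       S = mk⇔ (λ _ ()) (λ _ → tt)
T-survivesᵇ (R ∷ Rs) S = mk⇔ sound complete
  where
  open Equivalence
  sound : T (survivesᵇ (R ∷ Rs) S) → ∀ r → Monochromatic (lookup (lookup (R ∷ Rs) r)) S
  sound h zero    = to (T-monochromaticᵇ R S) (proj₁ (to T-∧ h))
  sound h (suc r) = to (T-survivesᵇ Rs S) (proj₂ (to T-∧ h)) r
  complete : (∀ r → Monochromatic (lookup (lookup (R ∷ Rs) r)) S) → T (survivesᵇ (R ∷ Rs) S)
  complete h = from T-∧ (from (T-monochromaticᵇ R S) (h zero) , from (T-survivesᵇ Rs S) (h ∘ suc))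

lookup-transpose : ∀ {n k} (c : Vec (Vec A k) n) r i → lookup (lookup (transpose c) r) i ≡ lookup (lookup c i) r
lookup-transpose (u ∷ w) r i = trans (cong (λ row → lookup row i) row-∷) (lookup-∷ i)
  where
  row-∷ : lookup (transpose (u ∷ w)) r ≡ lookup u r ∷ lookup (transpose w) r
  row-∷ = trans (cong (λ t → lookup t r) (transpose-∷ u w)) (lookup-zipWith _∷_ r u (transpose w))
  lookup-∷ : ∀ i → lookup (lookup u r ∷ lookup (transpose w) r) i ≡ lookup (lookup (u ∷ w) i) r
  lookup-∷ zero    = refl
  lookup-∷ (suc i) = lookup-transpose w r i

Monochromatic-transpose : ∀ {n k} (c : Vec (Vec A k) n) S →
  Monochromatic (lookup c) S ⇔ (∀ r → Monochromatic (lookup (lookup (transpose c) r)) S)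
Monochromatic-transpose c S = mk⇔ to from
  where
  open ≡-Reasoning
  to : Monochromatic (lookup c) S → ∀ r → Monochromatic (lookup (lookup (transpose c) r)) S
  to mono r {i} {j} i∈S j∈S = begin
    lookup (lookup (transpose c) r) i ≡⟨ lookup-transpose c r i ⟩
    lookup (lookup c i) r             ≡⟨ cong (λ v → lookup v r) (mono i∈S j∈S) ⟩
    lookup (lookup c j) r             ≡⟨ sym (lookup-transpose c r j) ⟩
    lookup (lookup (transpose c) r) j ∎
  from : (∀ r → Monochromatic (lookup (lookup (transpose c) r)) S) → Monochromatic (lookup c) S
  from mono {i} {j} i∈S j∈S = begin
    lookup c i                       ≡⟨ sym (tabulate∘lookup (lookup c i)) ⟩
    Vec.tabulate (lookup (lookup c i)) ≡⟨ tabulate-cong row-i≡row-j ⟩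
    Vec.tabulate (lookup (lookup c j)) ≡⟨ tabulate∘lookup (lookup c j) ⟩
    lookup c j                       ∎
    where
    row-i≡row-j : ∀ r → lookup (lookup c i) r ≡ lookup (lookup c j) r
    row-i≡row-j r = begin
      lookup (lookup c i) r             ≡⟨ sym (lookup-transpose c r i) ⟩
      lookup (lookup (transpose c) r) i ≡⟨ mono r i∈S j∈S ⟩
      lookup (lookup (transpose c) r) j ≡⟨ lookup-transpose c r j ⟩
      lookup (lookup c j) r             ∎

T-survivesᵇ-transpose : ∀ {n k} (c : Vec (Vec Bool k) n) S →
                        T (survivesᵇ (transpose c) S) ⇔ Monochromatic (lookup c) S
T-survivesᵇ-transpose c S = ⇔-trans (T-survivesᵇ (transpose c) S) (⇔-sym (Monochromatic-transpose c S))

-- When the monochromatic faces form the discrete complex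

Subsingleton : ∀ {n} → Subset n → Set
Subsingleton S = ∀ {i j} → i ∈ S → j ∈ S → i ≡ j

subsingleton-or-distinct : ∀ {n} (S : Subset n) → Subsingleton S ⊎ ∃₂ λ i j → i ∈ S × j ∈ S × i ≢ j
subsingleton-or-distinct S with any? (λ i → any? (λ j → (i ∈? S) ×-dec (j ∈? S) ×-dec ¬? (i ≟ j)))
... | yes (i , j , i∈S , j∈S , i≢j) = inj₂ (i , j , i∈S , j∈S , i≢j)
... | no  ¬distinct                 = inj₁ λ {i} {j} i∈S j∈S →
  decidable-stable (i ≟ j) λ i≢j → ¬distinct (i , j , i∈S , j∈S , i≢j)

∈⇒1≤∣∣ : ∀ {n} {i : Fin n} {S} → i ∈ S → 1 ≤ ∣ S ∣
∈⇒1≤∣∣ {i = i} {S} i∈S = subst (_≤ ∣ S ∣) (∣⁅x⁆∣≡1 i) (p⊆q⇒∣p∣≤∣q∣ ⁅i⁆⊆S)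
  where
  ⁅i⁆⊆S : ⁅ i ⁆ ⊆ S
  ⁅i⁆⊆S j∈⁅i⁆ = subst (_∈ S) (sym (x∈⁅y⁆⇒x≡y i j∈⁅i⁆)) i∈S

distinct⇒2≤∣∣ : ∀ {n} {i j : Fin n} {S} → i ∈ S → j ∈ S → i ≢ j → 2 ≤ ∣ S ∣
distinct⇒2≤∣∣ i∈S j∈S i≢j = ≤-trans (s≤s (∈⇒1≤∣∣ (x∈p∧x≢y⇒x∈p-y j∈S (i≢j ∘ sym)))) (x∈p⇒∣p-x∣<∣p∣ i∈S)

2≤⇒≡ᵇ1≡false : ∀ {m} → 2 ≤ m → (m ≡ᵇ 1) ≡ false
2≤⇒≡ᵇ1≡false (s≤s (s≤s _)) = refl

mem-subsingleton : ∀ {n} (C : SimplicialComplex n) {S} → Subsingleton S → mem C S ≡ (∣ S ∣ ≡ᵇ 1)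
mem-subsingleton {n} C {S} sub with nonempty? S
... | no  S-empty = begin
  mem C S         ≡⟨ ¬-not (S-empty ∘ nonempty C S ∘ Equivalence.from T-≡) ⟩
  false           ≡⟨ cong (_≡ᵇ 1) (sym (∣⊥∣≡0 n)) ⟩
  ∣ ⊥ {n} ∣ ≡ᵇ 1 ≡⟨ cong (λ S → ∣ S ∣ ≡ᵇ 1) (sym (Empty-unique S-empty)) ⟩
  ∣ S ∣ ≡ᵇ 1      ∎
  where open ≡-Reasoning
... | yes (i , i∈S) = begin
  mem C S        ≡⟨ Equivalence.to T-≡ (subst (T ∘ mem C) (sym S≡⁅i⁆) (singletons C i)) ⟩
  true           ≡⟨ cong (_≡ᵇ 1) (sym (∣⁅x⁆∣≡1 i)) ⟩
  ∣ ⁅ i ⁆ ∣ ≡ᵇ 1 ≡⟨ cong (λ S → ∣ S ∣ ≡ᵇ 1) (sym S≡⁅i⁆) ⟩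
  ∣ S ∣ ≡ᵇ 1      ∎
  where
  open ≡-Reasoning
  S≡⁅i⁆ : S ≡ ⁅ i ⁆
  S≡⁅i⁆ = ⊆-antisym (λ j∈S → subst (_∈ ⁅ i ⁆) (sub i∈S j∈S) (x∈⁅x⁆ i))
                    (λ j∈⁅i⁆ → subst (_∈ S) (sym (x∈⁅y⁆⇒x≡y i j∈⁅i⁆)) i∈S)

ProperColouring : ∀ {n} → SimplicialComplex n → (Fin n → A) → Set _
ProperColouring C κ = ∀ i j → i ≢ j → T (mem C (⁅ i ⁆ ∪ ⁅ j ⁆)) → κ i ≢ κ j

module _ {n} {i j : Fin n} where

  ∈-pairˡ : i ∈ ⁅ i ⁆ ∪ ⁅ j ⁆
  ∈-pairˡ = x∈p∪q⁺ (inj₁ (x∈⁅x⁆ i))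

  ∈-pairʳ : j ∈ ⁅ i ⁆ ∪ ⁅ j ⁆
  ∈-pairʳ = x∈p∪q⁺ (inj₂ (x∈⁅x⁆ j))

  ∈-pair⁻ : ∀ {x} → x ∈ ⁅ i ⁆ ∪ ⁅ j ⁆ → x ≡ i ⊎ x ≡ j
  ∈-pair⁻ x∈ij = Sum.map (x∈⁅y⁆⇒x≡y i) (x∈⁅y⁆⇒x≡y j) (x∈p∪q⁻ ⁅ i ⁆ ⁅ j ⁆ x∈ij)

  pair⊆ : ∀ {S} → i ∈ S → j ∈ S → ⁅ i ⁆ ∪ ⁅ j ⁆ ⊆ S
  pair⊆ i∈S j∈S x∈ij with ∈-pair⁻ x∈ij
  ... | inj₁ refl = i∈S
  ... | inj₂ refl = j∈S

  Monochromatic-pair : ∀ (κ : Fin n → A) → κ i ≡ κ j → Monochromatic κ (⁅ i ⁆ ∪ ⁅ j ⁆)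
  Monochromatic-pair κ κi≡κj x∈ij y∈ij with ∈-pair⁻ x∈ij | ∈-pair⁻ y∈ij
  ... | inj₁ refl | inj₁ refl = refl
  ... | inj₁ refl | inj₂ refl = κi≡κj
  ... | inj₂ refl | inj₁ refl = sym κi≡κj
  ... | inj₂ refl | inj₂ refl = refl

T⇔T⇒≡ : ∀ {a b} → T a ⇔ T b → a ≡ b
T⇔T⇒≡ T-a⇔T-b = ⇔→≡ {z = true} (⇔-trans (⇔-sym T-≡) (⇔-trans T-a⇔T-b T-≡))

module _ {n} (C : SimplicialComplex n) (κ : Fin n → A) (D : Subset n → Bool)
         (T-D : ∀ S → T (D S) ⇔ (T (mem C S) × Monochromatic κ S)) where
  open Equivalence

  discrete⇒proper : (∀ S → D S ≡ (∣ S ∣ ≡ᵇ 1)) → ProperColouring C κ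
  discrete⇒proper discrete i j i≢j ij∈C κi≡κj = subst T (trans (discrete (⁅ i ⁆ ∪ ⁅ j ⁆)) ∣ij∣≢1) ij∈D
    where
    ij∈D : T (D (⁅ i ⁆ ∪ ⁅ j ⁆))
    ij∈D = from (T-D _) (ij∈C , Monochromatic-pair κ κi≡κj)
    ∣ij∣≢1 : (∣ ⁅ i ⁆ ∪ ⁅ j ⁆ ∣ ≡ᵇ 1) ≡ false
    ∣ij∣≢1 = 2≤⇒≡ᵇ1≡false (distinct⇒2≤∣∣ ∈-pairˡ ∈-pairʳ i≢j)

  proper⇒discrete : ProperColouring C κ → ∀ S → D S ≡ (∣ S ∣ ≡ᵇ 1)
  proper⇒discrete proper S with subsingleton-or-distinct S
  ... | inj₁ sub = trans (T⇔T⇒≡ (mk⇔ (proj₁ ∘ to (T-D S)) (λ S∈C → from (T-D S) (S∈C , S-mono))))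
                         (mem-subsingleton C sub)
    where
    S-mono : Monochromatic κ S
    S-mono i∈S j∈S = cong κ (sub i∈S j∈S)
  ... | inj₂ (i , j , i∈S , j∈S , i≢j) =
    trans (¬-not S∉D) (sym (2≤⇒≡ᵇ1≡false (distinct⇒2≤∣∣ i∈S j∈S i≢j)))
    where
    S∉D : D S ≢ true
    S∉D S∈D with to (T-D S) (from T-≡ S∈D)
    ... | S∈C , S-mono = proper i j i≢j (downClosed C S _ (i , ∈-pairˡ) (pair⊆ i∈S j∈S) S∈C) (S-mono i∈S j∈S)

  discrete⇔proper : (∀ S → D S ≡ (∣ S ∣ ≡ᵇ 1)) ⇔ ProperColouring C κ
  discrete⇔proper = mk⇔ discrete⇒proper proper⇒discrete

T-run-transpose : ∀ {n k} (C : SimplicialComplex n) (c : Vec (Vec Bool k) n) S →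
                  T (run (transpose c) (mem C) S) ⇔ (T (mem C S) × Monochromatic (lookup c) S)
T-run-transpose C c S = begin
  T (run (transpose c) (mem C) S)                    ≡⟨ cong T (run-survivesᵇ (transpose c) (mem C) S) ⟩
  T (mem C S ∧ survivesᵇ (transpose c) S)            ≈⟨ T-∧ ⟩
  (T (mem C S) × T (survivesᵇ (transpose c) S))      ≈⟨ ⇔-refl ×-cong T-survivesᵇ-transpose c S ⟩
  (T (mem C S) × Monochromatic (lookup c) S)         ∎
  where open ⇔-Reasoning

-- The Boolean tests of the definitions

T-allᵇ : ∀ {p : A → Bool} {P : A → Set} {xs} → (∀ x → x List.∈ xs) → (∀ x → T (p x) ⇔ P x) →
         T (allᵇ p xs) ⇔ (∀ x → P x)
T-allᵇ {p = p} {P} {xs} xs-complete T-p⇔P = mk⇔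
  (λ h x → to (T-p⇔P x) (All.lookup (sound xs h) (xs-complete x)))
  (λ h → complete xs (All.tabulate (λ {x} _ → from (T-p⇔P x) (h x))))
  where
  open Equivalence
  sound : ∀ ys → T (allᵇ p ys) → All (T ∘ p) ys
  sound []       _ = []
  sound (y ∷ ys) h = proj₁ (to T-∧ h) ∷ sound ys (proj₂ (to T-∧ h))
  complete : ∀ ys → All (T ∘ p) ys → T (allᵇ p ys)
  complete []       []         = tt
  complete (y ∷ ys) (py ∷ pys) = from T-∧ (py , complete ys pys)

∈-allVecs : ∀ {xs : List A} → (∀ x → x List.∈ xs) → ∀ {n} (v : Vec A n) → v List.∈ allVecs xs n
∈-allVecs xs-complete []                = Any.here refl
∈-allVecs {xs = xs} xs-complete {suc n} (x ∷ v) =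
  ∈-concatMap⁺ (λ y → map (y ∷_) (allVecs xs n))
               (Any.map (λ { refl → ∈-map⁺ (x ∷_) (∈-allVecs xs-complete v) }) (xs-complete x))

∈-allSubsets : ∀ {n} (S : Subset n) → S List.∈ allSubsets n
∈-allSubsets = ∈-allVecs λ { true → Any.here refl ; false → Any.there (Any.here refl) }

T-== : ∀ {a b} → T (a == b) ⇔ a ≡ b
T-== {true}  {true}  = mk⇔ (λ _ → refl) (λ _ → tt)
T-== {true}  {false} = mk⇔ (λ ()) (λ ())
T-== {false} {true}  = mk⇔ (λ ()) (λ ())
T-== {false} {false} = mk⇔ (λ _ → refl) (λ _ → tt)

T-absorbedᵇ : ∀ {n} (D : Subset n → Bool) → T (absorbedᵇ D) ⇔ (∀ S → D S ≡ (∣ S ∣ ≡ᵇ 1))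
T-absorbedᵇ D = T-allᵇ ∈-allSubsets (λ S → T-==)

T-edge⇒≢ : ∀ {n q} (C : SimplicialComplex n) (i j : Fin n) (x y : Fin q) →
           T (not (edgeᵇ C i j) ∨ not ⌊ x ≟ y ⌋) ⇔ (i ≢ j → T (mem C (⁅ i ⁆ ∪ ⁅ j ⁆)) → x ≢ y)
T-edge⇒≢ C i j x y with mem C (⁅ i ⁆ ∪ ⁅ j ⁆) | i ≟ j | x ≟ y
... | false | _       | _       = mk⇔ (λ _ _ ()) (λ _ → tt)
... | true  | yes i≡j | _       = mk⇔ (λ _ i≢j → ⊥-elim (i≢j i≡j)) (λ _ → tt)
... | true  | no  i≢j | yes x≡y = mk⇔ (λ ()) (λ proper → proper i≢j tt x≡y)
... | true  | no  _   | no  x≢y = mk⇔ (λ _ _ _ → x≢y) (λ _ → tt)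

T-properᵇ : ∀ {n q} (C : SimplicialComplex n) (d : Vec (Fin q) n) →
            T (properᵇ C d) ⇔ ProperColouring C (lookup d)
T-properᵇ C d = T-allᵇ ∈-allFin λ i → T-allᵇ ∈-allFin λ j → T-edge⇒≢ C i j (lookup d i) (lookup d j)

ProperColouring-map-injective : ∀ {n} {f : A → B} → (∀ {x y} → f x ≡ f y → x ≡ y) →
  (C : SimplicialComplex n) (c : Vec A n) → ProperColouring C (lookup (vmap f c)) ⇔ ProperColouring C (lookup c)
ProperColouring-map-injective {f = f} f-injective C c = mk⇔
  (λ proper i j i≢j ij∈C cᵢ≡cⱼ →
    proper i j i≢j ij∈C (trans (lookup-map i f c) (trans (cong f cᵢ≡cⱼ) (sym (lookup-map j f c)))))
  (λ proper i j i≢j ij∈C dᵢ≡dⱼ →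
    proper i j i≢j ij∈C (f-injective (trans (sym (lookup-map i f c)) (trans dᵢ≡dⱼ (lookup-map j f c)))))

absorbed≡proper : ∀ {n k} (C : SimplicialComplex n) (c : Vec (Vec Bool k) n) →
                  absorbedᵇ (run (transpose c) (mem C)) ≡ properᵇ C (vmap encode c)
absorbed≡proper C c = T⇔T⇒≡ (begin
  T (absorbedᵇ (run (transpose c) (mem C)))           ≈⟨ T-absorbedᵇ _ ⟩
  (∀ S → run (transpose c) (mem C) S ≡ (∣ S ∣ ≡ᵇ 1))  ≈⟨ discrete⇔proper C (lookup c) _ (T-run-transpose C c) ⟩
  ProperColouring C (lookup c)                        ≈⟨ ProperColouring-map-injective encode-injective C c ⟨
  ProperColouring C (lookup (vmap encode c))          ≈⟨ T-properᵇ C (vmap encode c) ⟨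
  T (properᵇ C (vmap encode c))                       ∎)
  where open ⇔-Reasoning

absorbedCount≡chromaticPolynomial : ∀ {n} (C : SimplicialComplex n) k →
                                    absorbedCount C k ≡ chromaticPolynomial C (2 ^ k)
absorbedCount≡chromaticPolynomial {n} C k = trans
  (count-Enumerates (allVecs-transpose-Enumerates (true ∷ false ∷ []) k n) (absorbed≡proper C))
  (sym (count-Enumerates (allVecs-Enumerates n (allFin-encode-Enumerates k)) (λ _ → refl)))

-- Imported only here: Data.Integer's +_ would make the sections (x +_) on ℕ above ambiguous.
open import Data.Integer using (+_)
open import Data.Rational.Unnormalised using (_/_; _≃_)
open import Data.Rational.Unnormalised.Properties using (≃-reflexive)

proposition6p2 : (n : ℕ) (C⁰ : SimplicialComplex n) (k : ℕ) →
    absorptionProbability C⁰ k ≃ _/_ (+ chromaticPolynomial C⁰ (2 ^ k)) (2 ^ (n * k)) {{m^n≢0 2 (n * k)}}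
proposition6p2 n C⁰ k = ≃-reflexive
  (cong (λ m → _/_ (+ m) (2 ^ (n * k)) {{m^n≢0 2 (n * k)}}) (absorbedCount≡chromaticPolynomial C⁰ k))
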